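{- Let $m\ge 6$ be even and let $f_2$ be the color-$2$ map of the Route E direction assignment defined below. Let $R_2=f_2^m|_{P_0}:P_0\to P_0$, and use coordinates $(x,y)\in\mathbb Z_m^2$ on $P_0$ in which $(x,y)$ corresponds to the vertex $(i,j,k)=(x,\,-y,\,y-x)$ (i.e. $x=i$, $y=i+k$). Let $L_2=\{(x,0):x\in\mathbb Z_m\}$, for $x\in\mathbb Z_m$ let $\rho_2(x)=\min\{t\ge1:R_2^t(x,0)\in L_2\}$ and define $T_2(x)$ by $R_2^{\rho_2(x)}(x,0)=(T_2(x),0)$. Then (with $x$ identified with its representative in $\{0,\dots,m-1\}$) \[T_2(x)=\begin{cases}1,&x=0,\\ m-1,&x=1,\\ 0,&x=2,\\ x-1,&3\le x\le m-1,\end{cases}\qquad \rho_2(x)=\begin{cases}1,&x=0,\\ m-1,&x=1,\\ 2m,&x=2,\\ m,&3\le x\le m-1.\end{cases}\]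
   Context: $V=(\mathbb Z_m)^3$ with points $v=(i,j,k)$, $e_0:=(1,0,0)$, $e_1':=(0,1,0)$, $e_2':=(0,0,1)$; "direction $0,1,2$" means adding $(1,0,0),(0,1,0),(0,0,1)$ respectively. $S(v)=i+j+k\pmod m$, $P_0=\{S=0\}$. The Route E direction assignment gives each vertex a triple $(d_0(v),d_1(v),d_2(v))$, a permutation of $(0,1,2)$, and $f_c(v)=v+(\text{direction }d_c(v))$. Rules (all coordinates mod $m$, integer ranges refer to representatives in $\{0,\dots,m-1\}$): if $S\notin\{0,1,2\}$, triple $(0,1,2)$. If $S=1$: $(1,0,2)$ if $i=0$, $(2,0,1)$ if $i\ne0$. If $S=2$: $(2,1,0)$ if $j=0$, $(0,1,2)$ if $j\ne0$. If $S=0$ and $m\equiv0,2\pmod6$: triple $(1,0,2)$ on $X_{102}=\{(0,0,0)\}\cup\{(i,1,m-1-i):1\le i\le m-3\}\cup\{(m-1,2,m-1)\}$; $(0,2,1)$ on $X_{021}=\{(0,1,m-1)\}\cup\{(i,m-i,0):1\le i\le m-3\}\cup\{(m-1,0,1)\}$; $(2,1,0)$ on $X_{210}=\{(0,j,m-j):2\le j\le m-1\}\cup\{(1,0,m-1)\}$; $(0,1,2)$ at $(m-2,1,1)$; $(2,0,1)$ at $(m-2,2,0)$; $(1,2,0)$ otherwise. If $S=0$ and $m\equiv4\pmod6$: $(1,0,2)$ on $Y_{102}=\{(0,0,0)\}\cup\{(i,1,m-1-i):2\le i\le m-3\}\cup\{(m-1,2,m-1)\}$; $(0,2,1)$ on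 $Y_{021}=\{(0,1,m-1)\}\cup\{(i,m-i,0):2\le i\le m-3\}\cup\{(m-1,0,1)\}$; $(2,1,0)$ on $Y_{210}=\{(0,j,m-j):2\le j\le m-1\}\cup\{(1,0,m-1)\}\cup\{(1,j,m-1-j):2\le j\le m-2\}\cup\{(2,0,m-2),(2,m-1,m-1)\}$; $(0,1,2)$ at $(1,1,m-2)$ and $(m-2,1,1)$; $(2,0,1)$ at $(1,m-1,0)$ and $(m-2,2,0)$; $(1,2,0)$ otherwise. Each step increases $S$ by $1$, so $f_2^m$ maps $P_0$ to itself. -}

module Defs where

open import Data.Nat using (ℕ; zero; suc; _+_; _*_; _∸_; _≡ᵇ_; _≤ᵇ_; _%_)
open import Data.Bool using (Bool; true; false; if_then_else_; _∧_; _∨_; not)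
open import Data.Product using (_×_; _,_; proj₁; proj₂)

-- Elements of ℤ_m are represented by ℕ-representatives in {0,…,m-1}.
-- All operations below preserve this range (for m ≥ 1).

inc : ℕ → ℕ → ℕ
inc m a = if suc a ≡ᵇ m then 0 else suc a

addm : ℕ → ℕ → ℕ → ℕ
addm m a b = if m ≤ᵇ (a + b) then (a + b) ∸ m else a + b

subm : ℕ → ℕ → ℕ → ℕ
subm m a b = if b ≤ᵇ a then a ∸ b else (m + a) ∸ b

negm : ℕ → ℕ → ℕ
negm m a = subm m 0 a

Vertex : Set
Vertex = ℕ × ℕ × ℕ

data Dir : Set where
  d0 d1 d2 : Dir

-- Triples (d_0(v), d_1(v), d_2(v))
Triple : Set
Triple = Dir × Dir × Dir

S : ℕ → Vertex → ℕ
S m (i , j , k) = addm m (addm m i j) k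

between : ℕ → ℕ → ℕ → Bool
between a x b = (a ≤ᵇ x) ∧ (x ≤ᵇ b)

eqV : Vertex → Vertex → Bool
eqV (i , j , k) (i' , j' , k') = (i ≡ᵇ i') ∧ (j ≡ᵇ j') ∧ (k ≡ᵇ k')

inX102 : ℕ → Vertex → Bool
inX102 m v@(i , j , k) =
  eqV v (0 , 0 , 0)
  ∨ (between 1 i (m ∸ 3) ∧ (j ≡ᵇ 1) ∧ (k ≡ᵇ (m ∸ 1) ∸ i))
  ∨ eqV v (m ∸ 1 , 2 , m ∸ 1)

inX021 : ℕ → Vertex → Bool
inX021 m v@(i , j , k) =
  eqV v (0 , 1 , m ∸ 1)
  ∨ (between 1 i (m ∸ 3) ∧ (j ≡ᵇ m ∸ i) ∧ (k ≡ᵇ 0))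
  ∨ eqV v (m ∸ 1 , 0 , 1)

inX210 : ℕ → Vertex → Bool
inX210 m v@(i , j , k) =
  ((i ≡ᵇ 0) ∧ between 2 j (m ∸ 1) ∧ (k ≡ᵇ m ∸ j))
  ∨ eqV v (1 , 0 , m ∸ 1)

inY102 : ℕ → Vertex → Bool
inY102 m v@(i , j , k) =
  eqV v (0 , 0 , 0)
  ∨ (between 2 i (m ∸ 3) ∧ (j ≡ᵇ 1) ∧ (k ≡ᵇ (m ∸ 1) ∸ i))
  ∨ eqV v (m ∸ 1 , 2 , m ∸ 1)

inY021 : ℕ → Vertex → Bool
inY021 m v@(i , j , k) =
  eqV v (0 , 1 , m ∸ 1)
  ∨ (between 2 i (m ∸ 3) ∧ (j ≡ᵇ m ∸ i) ∧ (k ≡ᵇ 0))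
  ∨ eqV v (m ∸ 1 , 0 , 1)

inY210 : ℕ → Vertex → Bool
inY210 m v@(i , j , k) =
  ((i ≡ᵇ 0) ∧ between 2 j (m ∸ 1) ∧ (k ≡ᵇ m ∸ j))
  ∨ eqV v (1 , 0 , m ∸ 1)
  ∨ ((i ≡ᵇ 1) ∧ between 2 j (m ∸ 2) ∧ (k ≡ᵇ (m ∸ 1) ∸ j))
  ∨ eqV v (2 , 0 , m ∸ 2)
  ∨ eqV v (2 , m ∸ 1 , m ∸ 1)

tripleS0 : ℕ → Vertex → Triple
tripleS0 m v with m % 6 ≡ᵇ 4
... | false =
  if inX102 m v then (d1 , d0 , d2)
  else if inX021 m v then (d0 , d2 , d1)
  else if inX210 m v then (d2 , d1 , d0)
  else if eqV v (m ∸ 2 , 1 , 1) then (d0 , d1 , d2)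
  else if eqV v (m ∸ 2 , 2 , 0) then (d2 , d0 , d1)
  else (d1 , d2 , d0)
... | true =
  if inY102 m v then (d1 , d0 , d2)
  else if inY021 m v then (d0 , d2 , d1)
  else if inY210 m v then (d2 , d1 , d0)
  else if eqV v (1 , 1 , m ∸ 2) ∨ eqV v (m ∸ 2 , 1 , 1) then (d0 , d1 , d2)
  else if eqV v (1 , m ∸ 1 , 0) ∨ eqV v (m ∸ 2 , 2 , 0) then (d2 , d0 , d1)
  else (d1 , d2 , d0)

routeE : ℕ → Vertex → Triple
routeE m v@(i , j , k) =
  if S m v ≡ᵇ 0 then tripleS0 m v
  else if S m v ≡ᵇ 1 then (if i ≡ᵇ 0 then (d1 , d0 , d2) else (d2 , d0 , d1))
  else if S m v ≡ᵇ 2 then (if j ≡ᵇ 0 then (d2 , d1 , d0) else (d0 , d1 , d2))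
  else (d0 , d1 , d2)

step : ℕ → Dir → Vertex → Vertex
step m d0 (i , j , k) = (inc m i , j , k)
step m d1 (i , j , k) = (i , inc m j , k)
step m d2 (i , j , k) = (i , j , inc m k)

f2 : ℕ → Vertex → Vertex
f2 m v = step m (proj₂ (proj₂ (routeE m v))) v

iter : {A : Set} → (A → A) → ℕ → A → A
iter f zero a = a
iter f (suc n) a = f (iter f n a)

toVertex : ℕ → ℕ × ℕ → Vertex
toVertex m (x , y) = (x , negm m y , subm m y x)

toCoord : ℕ → Vertex → ℕ × ℕ
toCoord m (i , j , k) = (i , addm m i k)

R2 : ℕ → ℕ × ℕ → ℕ × ℕ
R2 m p = toCoord m (iter (f2 m) m (toVertex m p))

T2claim : ℕ → ℕ → ℕ
T2claim m 0 = 1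
T2claim m 1 = m ∸ 1
T2claim m 2 = 0
T2claim m x = x ∸ 1

rho2claim : ℕ → ℕ → ℕ
rho2claim m 0 = 1
rho2claim m 1 = m ∸ 1
rho2claim m 2 = 2 * m
rho2claim m x = m

-- On P₀ every step of f₂ raises the layer S by one, and on the layers S ≥ 3 it moves in direction 2, which
-- leaves i and j unchanged; so R₂ (x , y) only depends on the Route E rule on the layers S = 0, 1, 2.
-- Evaluating that rule gives a table of R₂: away from the axes, the right column x = m − 1 and the diagonal
-- x = y it maps (x , y) to (x + 1 , y − 1), so orbits run along antidiagonals, on which x + y is constant.
-- The orbit of (x , 0) climbs to the top row, runs to the right column, jumps to the y-axis and runs back down
-- to the x-axis, turning once at the diagonal; the parity of x decides whether the diagonal is met on the way
-- up or on the way down. Adding up the lengths of the runs gives ρ₂ and T₂.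

module Submission where

open import Data.Bool using (true; false; if_then_else_)
open import Data.List using (_∷_; [])
open import Data.Nat
open import Data.Nat.DivMod
open import Data.Nat.Divisibility using (_∣_; divides)
open import Data.Nat.Properties
open import Data.Nat.Tactic.RingSolver using (solve; solve-∀)
open import Data.Product using (Σ; _×_; _,_; proj₁; proj₂)
open import Data.Sum using (_⊎_; inj₁; inj₂)
open import Data.Unit using (⊤)
open import Function using (_∘_)
open import Relation.Binary.Definitions using (tri<; tri≈; tri>)
open import Relation.Binary.PropositionalEquality
open import Relation.Nullary using (Dec; does; yes; no; ¬_; _×-dec_; _⊎-dec_)
open import Relation.Nullary.Decidable using (dec-true; dec-false; map′)
open import Algebra.Properties.CommutativeSemigroup +-commutativeSemigroup using (interchange)

open import Defs

≡ᵇ-true : ∀ {a b} → a ≡ b → (a ≡ᵇ b) ≡ true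
≡ᵇ-true {a} {b} = dec-true (a ≟ b)

≡ᵇ-false : ∀ {a b} → a ≢ b → (a ≡ᵇ b) ≡ false
≡ᵇ-false {a} {b} = dec-false (a ≟ b)

≤ᵇ-true : ∀ {a b} → a ≤ b → (a ≤ᵇ b) ≡ true
≤ᵇ-true {a} {b} = dec-true (a ≤? b)

≤ᵇ-false : ∀ {a b} → b < a → (a ≤ᵇ b) ≡ false
≤ᵇ-false {a} {b} b<a = dec-false (a ≤? b) (<⇒≱ b<a)

iter-+ : ∀ {A : Set} (f : A → A) m n a → iter f (m + n) a ≡ iter f m (iter f n a)
iter-+ f zero    n a = refl
iter-+ f (suc m) n a = cong f (iter-+ f m n a)

m+n≡o⇒m≤o : ∀ {m o} n → m + n ≡ o → m ≤ o
m+n≡o⇒m≤o {m} n refl = m≤m+n m n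

module Paths {A : Set} (f : A → A) (P : A → Set) where

  -- A record rather than a Σ-type, so that unification can read off its indices.
  record Path (n : ℕ) (a b : A) : Set where
    constructor path
    field
      reach : iter f n a ≡ b
      avoid : ∀ t → 0 < t → t < n → P (iter f t a)

  path-refl : ∀ {a} → Path 0 a a
  path-refl = path refl λ _ _ ()

  path-step : ∀ {a b} → f a ≡ b → Path 1 a b
  path-step fa≡b = path fa≡b λ { (suc _) _ (s≤s ()) }

  path-++ : ∀ {m n a b c} → Path m a b → (0 < n → P b) → Path n b c → Path (m + n) a c
  path-++ {m} {n} {a} {b} {c} (path reach₁ avoid₁) Pb (path reach₂ avoid₂) = path reach avoid
    where
    after : ∀ u → iter f (m + u) a ≡ iter f u b
    after u = trans (cong (λ s → iter f s a) (+-comm m u)) (trans (iter-+ f u m a) (cong (iter f u) reach₁))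
    reach : iter f (m + n) a ≡ c
    reach = trans (after n) reach₂
    avoid : ∀ t → 0 < t → t < m + n → P (iter f t a)
    avoid t 0<t t<m+n with <-cmp t m
    ... | tri< t<m _ _ = avoid₁ t 0<t t<m
    ... | tri≈ _ refl _ = subst P (sym reach₁) (Pb (+-cancelˡ-< m 0 n (subst (_< m + n) (sym (+-identityʳ m)) t<m+n)))
    ... | tri> _ _ m<t = subst P (sym (trans (cong (λ s → iter f s a) t≡m+u) (after u))) (avoid₂ u (m<n⇒0<n∸m m<t) u<n)
      where
      u = t ∸ m
      t≡m+u : t ≡ m + u
      t≡m+u = sym (m+[n∸m]≡n (<⇒≤ m<t))
      u<n : u < n
      u<n = +-cancelˡ-< m u n (subst (_< m + n) t≡m+u t<m+n)

  path-cast : ∀ {t t′ a a′ b b′} → t ≡ t′ → a ≡ a′ → b ≡ b′ → Path t a b → Path t′ a′ b′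
  path-cast refl refl refl p = p

  infixr 2 _⟶⟨_⟩_
  infix  3 _⟶⟨_⟩∎

  _⟶⟨_⟩_ : ∀ a {b c m n} → Path m a b → {{P b}} → Path n b c → Path (m + n) a c
  _⟶⟨_⟩_ a p {{Pb}} q = path-++ p (λ _ → Pb) q

  _⟶⟨_⟩∎ : ∀ a {b m} → Path m a b → Path m a b
  a ⟶⟨ p ⟩∎ = p

-- Modular arithmetic on the representatives {0, …, m − 1}

module Residues (m : ℕ) .{{_ : NonZero m}} where

  open ≡-Reasoning

  +-congˡ-% : ∀ {a a'} b → a % m ≡ a' % m → (a + b) % m ≡ (a' + b) % m
  +-congˡ-% {a} {a'} b e = begin
    (a + b) % m             ≡⟨ %-distribˡ-+ a b m ⟩
    (a % m + b % m) % m     ≡⟨ cong (λ z → (z + b % m) % m) e ⟩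
    (a' % m + b % m) % m    ≡⟨ %-distribˡ-+ a' b m ⟨
    (a' + b) % m            ∎

  +-congʳ-% : ∀ a {b b'} → b % m ≡ b' % m → (a + b) % m ≡ (a + b') % m
  +-congʳ-% a {b} {b'} e = begin
    (a + b) % m   ≡⟨ cong (_% m) (+-comm a b) ⟩
    (b + a) % m   ≡⟨ +-congˡ-% a e ⟩
    (b' + a) % m  ≡⟨ cong (_% m) (+-comm b' a) ⟩
    (a + b') % m  ∎

  %-idem : ∀ a → a % m % m ≡ a % m
  %-idem a = m%n%n≡m%n a m

  inc-below : ∀ {a} → suc a < m → inc m a ≡ suc a
  inc-below {a} 1+a<m = cong (if_then 0 else suc a) (≡ᵇ-false (<⇒≢ 1+a<m))

  inc-last : ∀ {a} → suc a ≡ m → inc m a ≡ 0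
  inc-last {a} 1+a≡m = cong (if_then 0 else suc a) (≡ᵇ-true 1+a≡m)

  inc≡% : ∀ {a} → a < m → inc m a ≡ suc a % m
  inc≡% {a} a<m with suc a ≟ m
  ... | yes 1+a≡m = trans (inc-last 1+a≡m) (sym (trans (cong (_% m) 1+a≡m) (n%n≡0 m)))
  ... | no 1+a≢m = trans (inc-below 1+a<m) (sym (m<n⇒m%n≡m 1+a<m))
    where
    1+a<m = ≤∧≢⇒< a<m 1+a≢m

  inc< : ∀ {a} → a < m → inc m a < m
  inc< {a} a<m = subst (_< m) (sym (inc≡% a<m)) (m%n<n (suc a) m)

  inc-% : ∀ {a} → a < m → inc m a % m ≡ suc a % m
  inc-% {a} a<m = trans (cong (_% m) (inc≡% a<m)) (%-idem (suc a))

  addm≡% : ∀ {a b} → a < m → b < m → addm m a b ≡ (a + b) % m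
  addm≡% {a} {b} a<m b<m with m ≤? a + b
  ... | yes m≤a+b = begin
    addm m a b        ≡⟨ cong (if_then a + b ∸ m else a + b) (≤ᵇ-true m≤a+b) ⟩
    a + b ∸ m         ≡⟨ m<n⇒m%n≡m (m<n+o⇒m∸n<o (a + b) m (+-mono-< a<m b<m)) ⟨
    (a + b ∸ m) % m   ≡⟨ m≤n⇒[n∸m]%m≡n%m m≤a+b ⟩
    (a + b) % m       ∎
  ... | no m≰a+b = trans (cong (if_then a + b ∸ m else a + b) (≤ᵇ-false (≰⇒> m≰a+b)))
                         (sym (m<n⇒m%n≡m (≰⇒> m≰a+b)))

  subm-≤ : ∀ {x y} → x ≤ y → subm m y x ≡ y ∸ x
  subm-≤ {x} {y} x≤y = cong (if_then y ∸ x else m + y ∸ x) (≤ᵇ-true x≤y)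

  subm-> : ∀ {x y} → y < x → subm m y x ≡ m + y ∸ x
  subm-> {x} {y} y<x = cong (if_then y ∸ x else m + y ∸ x) (≤ᵇ-false y<x)

  subm≡% : ∀ x {y} → y < m → subm m y x ≡ (m + y ∸ x) % m
  subm≡% x {y} y<m with x ≤? y
  ... | yes x≤y = begin
    subm m y x        ≡⟨ subm-≤ x≤y ⟩
    y ∸ x             ≡⟨ m<n⇒m%n≡m (≤-<-trans (m∸n≤m y x) y<m) ⟨
    (y ∸ x) % m       ≡⟨ [m+n]%n≡m%n (y ∸ x) m ⟨
    (y ∸ x + m) % m   ≡⟨ cong (_% m) (trans (+-comm (y ∸ x) m) (sym (+-∸-assoc m x≤y))) ⟩
    (m + y ∸ x) % m   ∎
  ... | no x≰y = trans (subm-> (≰⇒> x≰y)) (sym (m<n⇒m%n≡m (m<n+o⇒m∸n<o (m + y) x m+y<x+m)))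
    where
    m+y<x+m : m + y < x + m
    m+y<x+m = subst (m + y <_) (+-comm m x) (+-monoʳ-< m (≰⇒> x≰y))

  addm< : ∀ {a b} → a < m → b < m → addm m a b < m
  addm< {a} {b} a<m b<m = subst (_< m) (sym (addm≡% a<m b<m)) (m%n<n (a + b) m)

  subm< : ∀ x {y} → y < m → subm m y x < m
  subm< x {y} y<m = subst (_< m) (sym (subm≡% x y<m)) (m%n<n (m + y ∸ x) m)

  subm-diag : ∀ x → subm m x x ≡ 0
  subm-diag x = trans (subm-≤ {x} ≤-refl) (n∸n≡0 x)

  subm≢0 : ∀ {x y} → x < m → x ≢ y → subm m y x ≢ 0
  subm≢0 {x} {y} x<m x≢y with x ≤? y
  ... | yes x≤y = λ e → x≢y (≤-antisym x≤y (m∸n≡0⇒m≤n (trans (sym (subm-≤ x≤y)) e)))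
  ... | no x≰y = λ e → <⇒≱ x<m (≤-trans (m≤m+n m y) (m∸n≡0⇒m≤n (trans (sym (subm-> (≰⇒> x≰y))) e)))

  Valid : Vertex → Set
  Valid (i , j , k) = i < m × j < m × k < m

  ∑ : Vertex → ℕ
  ∑ (i , j , k) = i + j + k

  S≡∑% : ∀ {v} → Valid v → S m v ≡ ∑ v % m
  S≡∑% {i , j , k} (i<m , j<m , k<m) = begin
    addm m (addm m i j) k   ≡⟨ addm≡% (addm< i<m j<m) k<m ⟩
    (addm m i j + k) % m    ≡⟨ cong (λ z → (z + k) % m) (addm≡% i<m j<m) ⟩
    ((i + j) % m + k) % m   ≡⟨ +-congˡ-% k (%-idem (i + j)) ⟩
    (i + j + k) % m         ∎

  S< : ∀ {v} → Valid v → S m v < m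
  S< {v} v-valid = subst (_< m) (sym (S≡∑% v-valid)) (m%n<n (∑ v) m)

  step-valid : ∀ d {v} → Valid v → Valid (step m d v)
  step-valid d0 (i<m , j<m , k<m) = inc< i<m , j<m , k<m
  step-valid d1 (i<m , j<m , k<m) = i<m , inc< j<m , k<m
  step-valid d2 (i<m , j<m , k<m) = i<m , j<m , inc< k<m

  ∑-step : ∀ d {v} → Valid v → ∑ (step m d v) % m ≡ suc (∑ v) % m
  ∑-step d0 {i , j , k} (i<m , _ , _) = +-congˡ-% k (+-congˡ-% j (inc-% i<m))
  ∑-step d1 {i , j , k} (_ , j<m , _) =
    trans (+-congˡ-% k (+-congʳ-% i (inc-% j<m))) (cong (λ z → (z + k) % m) (+-suc i j))
  ∑-step d2 {i , j , k} (_ , _ , k<m) =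
    trans (+-congʳ-% (i + j) (inc-% k<m)) (cong (_% m) (+-suc (i + j) k))

  step-S : ∀ d {v} → Valid v → S m (step m d v) ≡ inc m (S m v)
  step-S d {v} v-valid = begin
    S m (step m d v)       ≡⟨ S≡∑% (step-valid d v-valid) ⟩
    ∑ (step m d v) % m     ≡⟨ ∑-step d v-valid ⟩
    suc (∑ v) % m          ≡⟨ +-congʳ-% 1 (%-idem (∑ v)) ⟨
    suc (∑ v % m) % m      ≡⟨ inc≡% (m%n<n (∑ v) m) ⟨
    inc m (∑ v % m)        ≡⟨ cong (inc m) (S≡∑% v-valid) ⟨
    inc m (S m v)          ∎

  toVertex-valid : ∀ {x y} → x < m → y < m → Valid (toVertex m (x , y))
  toVertex-valid {x} {y} x<m y<m = x<m , subm< y (>-nonZero⁻¹ m) , subm< x y<m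

  toVertex-S : ∀ {x y} → x < m → y < m → S m (toVertex m (x , y)) ≡ 0
  toVertex-S {x} {y} x<m y<m = begin
    S m (toVertex m (x , y))                              ≡⟨ S≡∑% (toVertex-valid x<m y<m) ⟩
    (x + negm m y + subm m y x) % m                       ≡⟨ cong₂ (λ a b → (x + a + b) % m)
                                                               (subm≡% y (>-nonZero⁻¹ m)) (subm≡% x y<m) ⟩
    (x + (m + 0 ∸ y) % m + (m + y ∸ x) % m) % m           ≡⟨ +-congˡ-% ((m + y ∸ x) % m) (+-congʳ-% x (%-idem (m + 0 ∸ y))) ⟩
    (x + (m + 0 ∸ y) + (m + y ∸ x) % m) % m               ≡⟨ +-congʳ-% (x + (m + 0 ∸ y)) (%-idem (m + y ∸ x)) ⟩
    (x + (m + 0 ∸ y) + (m + y ∸ x)) % m                   ≡⟨ cong (_% m) sum≡m+m ⟩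
    (m + m) % m                                           ≡⟨ trans ([m+n]%n≡m%n m m) (n%n≡0 m) ⟩
    0                                                     ∎
    where
    sum≡m+m : x + (m + 0 ∸ y) + (m + y ∸ x) ≡ m + m
    sum≡m+m = begin
      x + (m + 0 ∸ y) + (m + y ∸ x)    ≡⟨ cong₂ (λ a b → x + a + b) (cong (_∸ y) (+-identityʳ m))
                                                                     (+-∸-comm y (<⇒≤ x<m)) ⟩
      x + (m ∸ y) + (m ∸ x + y)        ≡⟨ interchange x (m ∸ y) (m ∸ x) y ⟩
      (x + (m ∸ x)) + ((m ∸ y) + y)    ≡⟨ cong₂ _+_ (m+[n∸m]≡n (<⇒≤ x<m)) (m∸n+n≡m (<⇒≤ y<m)) ⟩
      m + m                            ∎

  -- On P₀ the coordinate y = i + k of a vertex equals −j, so only i and j matter.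
  readoff : Vertex → ℕ × ℕ
  readoff (i , j , _) = (i , negm m j)

  toCoord≡readoff : ∀ {v} → Valid v → S m v ≡ 0 → toCoord m v ≡ readoff v
  toCoord≡readoff {i , j , k} v-valid@(i<m , j<m , k<m) S≡0 = cong (i ,_) (begin
    addm m i k                        ≡⟨ addm≡% i<m k<m ⟩
    (i + k) % m                       ≡⟨ [m+n]%n≡m%n (i + k) m ⟨
    (i + k + m) % m                   ≡⟨ cong (λ z → (i + k + z) % m) (m+[n∸m]≡n (<⇒≤ j<m)) ⟨
    (i + k + (j + (m ∸ j))) % m       ≡⟨ cong (_% m) (regroup i j k (m ∸ j)) ⟩
    (i + j + k + (m ∸ j)) % m         ≡⟨ +-congˡ-% (m ∸ j) (%-idem (i + j + k)) ⟨
    ((i + j + k) % m + (m ∸ j)) % m   ≡⟨ cong (λ z → (z + (m ∸ j)) % m) (trans (sym (S≡∑% v-valid)) S≡0) ⟩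
    (m ∸ j) % m                       ≡⟨ cong (λ z → (z ∸ j) % m) (+-identityʳ m) ⟨
    (m + 0 ∸ j) % m                   ≡⟨ subm≡% j (>-nonZero⁻¹ m) ⟨
    negm m j                          ∎)
    where
    regroup : ∀ a b c d → a + c + (b + d) ≡ a + b + c + d
    regroup = solve-∀

-- Layers of f₂

colour₂ : Triple → Dir
colour₂ (_ , _ , d) = d

-- f₂ and R₂ are only used through these opaque copies: the conversion checker would otherwise unfold
-- towers of f₂ (R2 m with m = 6 + n is already one), at a cost exponential in their height.
opaque
  F₂ : ℕ → Vertex → Vertex
  F₂ = f2

  F₂≡f2 : ∀ m v → F₂ m v ≡ f2 m v
  F₂≡f2 _ _ = refl

  R₂ : ℕ → ℕ × ℕ → ℕ × ℕ
  R₂ = R2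

  R₂≡R2 : ∀ m p → R₂ m p ≡ R2 m p
  R₂≡R2 _ _ = refl

module Layers (m : ℕ) .{{_ : NonZero m}} where

  open Residues m
  open ≡-Reasoning

  F₂-valid : ∀ {v} → Valid v → Valid (F₂ m v)
  F₂-valid {v} v-valid rewrite F₂≡f2 m v = step-valid (colour₂ (routeE m v)) v-valid

  F₂-S : ∀ {v} → Valid v → S m (F₂ m v) ≡ inc m (S m v)
  F₂-S {v} v-valid rewrite F₂≡f2 m v = step-S (colour₂ (routeE m v)) v-valid

  iter-F₂-valid : ∀ t {v} → Valid v → Valid (iter (F₂ m) t v)
  iter-F₂-valid zero    v-valid = v-valid
  iter-F₂-valid (suc t) v-valid = F₂-valid (iter-F₂-valid t v-valid)

  iter-F₂-S : ∀ t {v} → Valid v → S m (iter (F₂ m) t v) ≡ (S m v + t) % m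
  iter-F₂-S zero {v} v-valid = begin
    S m v             ≡⟨ m<n⇒m%n≡m (S< v-valid) ⟨
    S m v % m         ≡⟨ cong (_% m) (+-identityʳ (S m v)) ⟨
    (S m v + 0) % m   ∎
  iter-F₂-S (suc t) {v} v-valid = begin
    S m (F₂ m w)                  ≡⟨ F₂-S (iter-F₂-valid t v-valid) ⟩
    inc m (S m w)                 ≡⟨ inc≡% (S< (iter-F₂-valid t v-valid)) ⟩
    suc (S m w) % m               ≡⟨ +-congʳ-% 1 (trans (cong (_% m) (iter-F₂-S t v-valid)) (%-idem (S m v + t))) ⟩
    suc (S m v + t) % m           ≡⟨ cong (_% m) (+-suc (S m v) t) ⟨
    (S m v + suc t) % m           ∎
    where
    w = iter (F₂ m) t v

  F₂-layer0 : ∀ {v} → S m v ≡ 0 → F₂ m v ≡ step m (colour₂ (tripleS0 m v)) v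
  F₂-layer0 {v} S≡0 rewrite F₂≡f2 m v | S≡0 = refl

  F₂-layer1-i≡0 : ∀ {j k} → S m (0 , j , k) ≡ 1 → F₂ m (0 , j , k) ≡ step m d2 (0 , j , k)
  F₂-layer1-i≡0 {j} {k} S≡1 rewrite F₂≡f2 m (0 , j , k) | S≡1 = refl

  F₂-layer1-i≢0 : ∀ {i j k} → S m (i , j , k) ≡ 1 → i ≢ 0 → F₂ m (i , j , k) ≡ step m d1 (i , j , k)
  F₂-layer1-i≢0 {i} {j} {k} S≡1 i≢0 rewrite F₂≡f2 m (i , j , k) | S≡1 | ≡ᵇ-false i≢0 = refl

  F₂-layer2-j≡0 : ∀ {i k} → S m (i , 0 , k) ≡ 2 → F₂ m (i , 0 , k) ≡ step m d0 (i , 0 , k)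
  F₂-layer2-j≡0 {i} {k} S≡2 rewrite F₂≡f2 m (i , 0 , k) | S≡2 = refl

  F₂-layer2-j≢0 : ∀ {i j k} → S m (i , j , k) ≡ 2 → j ≢ 0 → F₂ m (i , j , k) ≡ step m d2 (i , j , k)
  F₂-layer2-j≢0 {i} {j} {k} S≡2 j≢0 rewrite F₂≡f2 m (i , j , k) | S≡2 | ≡ᵇ-false j≢0 = refl

  F₂-high : ∀ {v s} → S m v ≡ 3 + s → F₂ m v ≡ step m d2 v
  F₂-high {v} S≡3+s rewrite F₂≡f2 m v | S≡3+s = refl

  readoff-high : ∀ t {v} → Valid v → S m v ≡ 0 → 3 ≤ t → t ≤ m →
                 readoff (iter (F₂ m) t v) ≡ readoff (iter (F₂ m) 3 v)
  readoff-high 1 _ _ (s≤s ()) _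
  readoff-high 2 _ _ (s≤s (s≤s ())) _
  readoff-high 3 _ _ _ _ = refl
  readoff-high (suc t@(suc (suc (suc _)))) {v} v-valid S≡0 _ t<m = begin
    readoff (F₂ m w)            ≡⟨ cong readoff (F₂-high S≡t) ⟩
    readoff (step m d2 w)       ≡⟨⟩
    readoff w                   ≡⟨ readoff-high t v-valid S≡0 (s≤s (s≤s (s≤s z≤n))) (<⇒≤ t<m) ⟩
    readoff (iter (F₂ m) 3 v)   ∎
    where
    w = iter (F₂ m) t v
    S≡t : S m w ≡ t
    S≡t = trans (iter-F₂-S t v-valid) (trans (cong (λ s → (s + t) % m) S≡0) (m<n⇒m%n≡m t<m))

  iter-f2≡iter-F₂ : ∀ t v → iter (f2 m) t v ≡ iter (F₂ m) t v
  iter-f2≡iter-F₂ zero    v = refl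
  iter-f2≡iter-F₂ (suc t) v =
    trans (cong (f2 m) {iter (f2 m) t v} {iter (F₂ m) t v} (iter-f2≡iter-F₂ t v)) (sym (F₂≡f2 m (iter (F₂ m) t v)))

  R2≡readoff-F₂³ : 3 ≤ m → ∀ {x y} → x < m → y < m →
                   R2 m (x , y) ≡ readoff (iter (F₂ m) 3 (toVertex m (x , y)))
  R2≡readoff-F₂³ 3≤m {x} {y} x<m y<m = begin
    toCoord m (iter (f2 m) m v)    ≡⟨ cong (toCoord m) (iter-f2≡iter-F₂ m v) ⟩
    toCoord m (iter (F₂ m) m v)    ≡⟨ toCoord≡readoff (iter-F₂-valid m v-valid) S-end ⟩
    readoff (iter (F₂ m) m v)      ≡⟨ readoff-high m v-valid S-start 3≤m ≤-refl ⟩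
    readoff (iter (F₂ m) 3 v)      ∎
    where
    v = toVertex m (x , y)
    v-valid = toVertex-valid x<m y<m
    S-start = toVertex-S x<m y<m
    S-end : S m (iter (F₂ m) m v) ≡ 0
    S-end = trans (iter-F₂-S m v-valid) (trans (cong (λ s → (s + m) % m) S-start) (n%n≡0 m))

  module FromLayer1 (3≤m : 3 ≤ m) {x y : ℕ} (x<m : x < m) (y<m : y < m) {v : Vertex}
                    (v≡ : toVertex m (x , y) ≡ v) {δ : Dir} (layer0 : colour₂ (tripleS0 m v) ≡ δ) where

    -- (i₁ , j₁ , k₁) denotes the vertex step m δ v reached on layer 1.

    private
      v-valid : Valid v
      v-valid = subst Valid v≡ (toVertex-valid x<m y<m)

      v-S : S m v ≡ 0
      v-S = trans (cong (S m) (sym v≡)) (toVertex-S x<m y<m)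

      on-layer1 : ∀ {w} → step m δ v ≡ w → Valid w × S m w ≡ 1
      on-layer1 refl = step-valid δ v-valid ,
                       trans (step-S δ v-valid) (trans (cong (inc m) v-S) (inc-below (≤-trans (s≤s (s≤s z≤n)) 3≤m)))

      onto-layer2 : ∀ d {w} → Valid w → S m w ≡ 1 → S m (step m d w) ≡ 2
      onto-layer2 d w-valid S≡1 = trans (step-S d w-valid) (trans (cong (inc m) S≡1) (inc-below 3≤m))

      R₂≡readoff-F₂² : ∀ {w} → step m δ v ≡ w → R₂ m (x , y) ≡ readoff (F₂ m (F₂ m w))
      R₂≡readoff-F₂² refl = begin
        R₂ m (x , y)                                    ≡⟨ R₂≡R2 m (x , y) ⟩
        R2 m (x , y)                                    ≡⟨ R2≡readoff-F₂³ 3≤m x<m y<m ⟩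
        readoff (iter (F₂ m) 3 (toVertex m (x , y)))    ≡⟨ cong (readoff ∘ iter (F₂ m) 3) v≡ ⟩
        readoff (F₂ m (F₂ m (F₂ m v)))                  ≡⟨ cong (readoff ∘ F₂ m ∘ F₂ m) (F₂-layer0 v-S) ⟩
        readoff (F₂ m (F₂ m (step m (colour₂ (tripleS0 m v)) v)))
                                                        ≡⟨ cong (λ d → readoff (F₂ m (F₂ m (step m d v)))) layer0 ⟩
        readoff (F₂ m (F₂ m (step m δ v)))              ∎

    R2-i₁≡0-j₁≢0 : ∀ {j k} → step m δ v ≡ (0 , j , k) → j ≢ 0 → R₂ m (x , y) ≡ (0 , negm m j)
    R2-i₁≡0-j₁≢0 {j} {k} v₁≡ j≢0 = begin
      R₂ m (x , y)                        ≡⟨ R₂≡readoff-F₂² v₁≡ ⟩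
      readoff (F₂ m (F₂ m (0 , j , k)))   ≡⟨ cong (readoff ∘ F₂ m) (F₂-layer1-i≡0 S≡1) ⟩
      readoff (F₂ m (0 , j , inc m k))    ≡⟨ cong readoff (F₂-layer2-j≢0 (onto-layer2 d2 valid S≡1) j≢0) ⟩
      (0 , negm m j)                      ∎
      where open Σ (on-layer1 v₁≡) renaming (proj₁ to valid; proj₂ to S≡1)

    R2-i₁≡0-j₁≡0 : ∀ {k} → step m δ v ≡ (0 , 0 , k) → R₂ m (x , y) ≡ (1 , 0)
    R2-i₁≡0-j₁≡0 {k} v₁≡ = begin
      R₂ m (x , y)                        ≡⟨ R₂≡readoff-F₂² v₁≡ ⟩
      readoff (F₂ m (F₂ m (0 , 0 , k)))   ≡⟨ cong (readoff ∘ F₂ m) (F₂-layer1-i≡0 S≡1) ⟩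
      readoff (F₂ m (0 , 0 , inc m k))    ≡⟨ cong readoff (F₂-layer2-j≡0 (onto-layer2 d2 valid S≡1)) ⟩
      (inc m 0 , 0)                       ≡⟨ cong (_, 0) (inc-below (≤-trans (s≤s (s≤s z≤n)) 3≤m)) ⟩
      (1 , 0)                             ∎
      where open Σ (on-layer1 v₁≡) renaming (proj₁ to valid; proj₂ to S≡1)

    R2-i₁≢0 : ∀ {i j k} → step m δ v ≡ (i , j , k) → i ≢ 0 → suc j < m → R₂ m (x , y) ≡ (i , negm m (suc j))
    R2-i₁≢0 {i} {j} {k} v₁≡ i≢0 1+j<m = begin
      R₂ m (x , y)                        ≡⟨ R₂≡readoff-F₂² v₁≡ ⟩
      readoff (F₂ m (F₂ m (i , j , k)))   ≡⟨ cong (readoff ∘ F₂ m) (F₂-layer1-i≢0 S≡1 i≢0) ⟩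
      readoff (F₂ m (i , inc m j , k))    ≡⟨ cong (λ b → readoff (F₂ m (i , b , k))) (inc-below 1+j<m) ⟩
      readoff (F₂ m (i , suc j , k))      ≡⟨ cong readoff (F₂-layer2-j≢0 S≡2 (λ ())) ⟩
      (i , negm m (suc j))                ∎
      where
      open Σ (on-layer1 v₁≡) renaming (proj₁ to valid; proj₂ to S≡1)
      S≡2 : S m (i , suc j , k) ≡ 2
      S≡2 = subst (λ b → S m (i , b , k) ≡ 2) (inc-below 1+j<m) (onto-layer2 d1 valid S≡1)

    R2-i₁≢0-j₁≡top : ∀ {i j k} → step m δ v ≡ (i , j , k) → i ≢ 0 → suc j ≡ m → R₂ m (x , y) ≡ (inc m i , 0)
    R2-i₁≢0-j₁≡top {i} {j} {k} v₁≡ i≢0 1+j≡m = begin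
      R₂ m (x , y)                        ≡⟨ R₂≡readoff-F₂² v₁≡ ⟩
      readoff (F₂ m (F₂ m (i , j , k)))   ≡⟨ cong (readoff ∘ F₂ m) (F₂-layer1-i≢0 S≡1 i≢0) ⟩
      readoff (F₂ m (i , inc m j , k))    ≡⟨ cong (λ b → readoff (F₂ m (i , b , k))) inc≡0 ⟩
      readoff (F₂ m (i , 0 , k))          ≡⟨ cong readoff (F₂-layer2-j≡0 S≡2) ⟩
      (inc m i , 0)                       ∎
      where
      open Σ (on-layer1 v₁≡) renaming (proj₁ to valid; proj₂ to S≡1)
      inc≡0 : inc m j ≡ 0
      inc≡0 = inc-last 1+j≡m
      S≡2 : S m (i , 0 , k) ≡ 2
      S≡2 = subst (λ b → S m (i , b , k) ≡ 2) inc≡0 (onto-layer2 d1 valid S≡1)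

-- The colour-2 direction on P₀

_≟ᵛ_ : (v w : Vertex) → Dec (v ≡ w)
(i , j , k) ≟ᵛ (i' , j' , k') =
  map′ (λ { (refl , refl , refl) → refl }) (λ { refl → refl , refl , refl })
       (i ≟ i' ×-dec j ≟ j' ×-dec k ≟ k')

colour₂-if : ∀ b {x y d} → colour₂ x ≡ d → colour₂ y ≡ d → colour₂ (if b then x else y) ≡ d
colour₂-if true  p _ = p
colour₂-if false _ q = q

-- In102 1 and In021 1 are X₁₀₂ and X₀₂₁, In102 2 and In021 2 are Y₁₀₂ and Y₀₂₁. Like _≟ᵛ_, whose `does`
-- is eqV, the deciders are built so that their `does` is definitionally inX102, inX021, inY102, inY021.
module LayerZeroSets (m : ℕ) where

  In102 : ℕ → Vertex → Set
  In102 lo v@(i , j , k) =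
    v ≡ (0 , 0 , 0) ⊎ (lo ≤ i × i ≤ m ∸ 3) × j ≡ 1 × k ≡ m ∸ 1 ∸ i ⊎ v ≡ (m ∸ 1 , 2 , m ∸ 1)

  in102? : ∀ lo v → Dec (In102 lo v)
  in102? lo v@(i , j , k) =
    v ≟ᵛ (0 , 0 , 0) ⊎-dec (lo ≤? i ×-dec i ≤? m ∸ 3) ×-dec j ≟ 1 ×-dec k ≟ m ∸ 1 ∸ i ⊎-dec v ≟ᵛ (m ∸ 1 , 2 , m ∸ 1)

  In021 : ℕ → Vertex → Set
  In021 lo v@(i , j , k) =
    v ≡ (0 , 1 , m ∸ 1) ⊎ (lo ≤ i × i ≤ m ∸ 3) × j ≡ m ∸ i × k ≡ 0 ⊎ v ≡ (m ∸ 1 , 0 , 1)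

  in021? : ∀ lo v → Dec (In021 lo v)
  in021? lo v@(i , j , k) =
    v ≟ᵛ (0 , 1 , m ∸ 1) ⊎-dec (lo ≤? i ×-dec i ≤? m ∸ 3) ×-dec j ≟ m ∸ i ×-dec k ≟ 0 ⊎-dec v ≟ᵛ (m ∸ 1 , 0 , 1)

  In102-mono : ∀ {lo lo' v} → lo ≤ lo' → In102 lo' v → In102 lo v
  In102-mono lo≤lo' (inj₁ e) = inj₁ e
  In102-mono lo≤lo' (inj₂ (inj₁ ((lo'≤i , i≤) , rest))) = inj₂ (inj₁ ((≤-trans lo≤lo' lo'≤i , i≤) , rest))
  In102-mono lo≤lo' (inj₂ (inj₂ e)) = inj₂ (inj₂ e)

  In021-mono : ∀ {lo lo' v} → lo ≤ lo' → In021 lo' v → In021 lo v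
  In021-mono lo≤lo' (inj₁ e) = inj₁ e
  In021-mono lo≤lo' (inj₂ (inj₁ ((lo'≤i , i≤) , rest))) = inj₂ (inj₁ ((≤-trans lo≤lo' lo'≤i , i≤) , rest))
  In021-mono lo≤lo' (inj₂ (inj₂ e)) = inj₂ (inj₂ e)

  ∉102 : ∀ {lo i j k} → j ≢ 1 → (i , j , k) ≢ (0 , 0 , 0) → (i , j , k) ≢ (m ∸ 1 , 2 , m ∸ 1) →
         ¬ In102 lo (i , j , k)
  ∉102 j≢1 ≢o ≢c (inj₁ e) = ≢o e
  ∉102 j≢1 ≢o ≢c (inj₂ (inj₁ (_ , j≡1 , _))) = j≢1 j≡1
  ∉102 j≢1 ≢o ≢c (inj₂ (inj₂ e)) = ≢c e

  ∉102-beyond : ∀ {lo i j k} → m ∸ 3 < i → (i , j , k) ≢ (0 , 0 , 0) → (i , j , k) ≢ (m ∸ 1 , 2 , m ∸ 1) →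
                ¬ In102 lo (i , j , k)
  ∉102-beyond i>m-3 ≢o ≢c (inj₁ e) = ≢o e
  ∉102-beyond i>m-3 ≢o ≢c (inj₂ (inj₁ ((_ , i≤m-3) , _))) = <⇒≱ i>m-3 i≤m-3
  ∉102-beyond i>m-3 ≢o ≢c (inj₂ (inj₂ e)) = ≢c e

  ∉021 : ∀ {lo i j k} → k ≢ 0 → (i , j , k) ≢ (0 , 1 , m ∸ 1) → (i , j , k) ≢ (m ∸ 1 , 0 , 1) →
         ¬ In021 lo (i , j , k)
  ∉021 k≢0 ≢a ≢b (inj₁ e) = ≢a e
  ∉021 k≢0 ≢a ≢b (inj₂ (inj₁ (_ , _ , k≡0))) = k≢0 k≡0
  ∉021 k≢0 ≢a ≢b (inj₂ (inj₂ e)) = ≢b e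

  ∉021-beyond : ∀ {lo i j k} → m ∸ 3 < i → (i , j , k) ≢ (0 , 1 , m ∸ 1) → (i , j , k) ≢ (m ∸ 1 , 0 , 1) →
                ¬ In021 lo (i , j , k)
  ∉021-beyond i>m-3 ≢a ≢b (inj₁ e) = ≢a e
  ∉021-beyond i>m-3 ≢a ≢b (inj₂ (inj₁ ((_ , i≤m-3) , _))) = <⇒≱ i>m-3 i≤m-3
  ∉021-beyond i>m-3 ≢a ≢b (inj₂ (inj₂ e)) = ≢b e

module LayerZero (n : ℕ) where
  m = 6 + n
  open LayerZeroSets m

  private
    in102-true : ∀ lo v → In102 lo v → does (in102? lo v) ≡ true
    in102-true lo v = dec-true (in102? lo v)

    in102-false : ∀ lo v → ¬ In102 lo v → does (in102? lo v) ≡ false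
    in102-false lo v = dec-false (in102? lo v)

    in021-true : ∀ lo v → In021 lo v → does (in021? lo v) ≡ true
    in021-true lo v = dec-true (in021? lo v)

    in021-false : ∀ lo v → ¬ In021 lo v → does (in021? lo v) ≡ false
    in021-false lo v = dec-false (in021? lo v)

    eqV-refl : ∀ v → eqV v v ≡ true
    eqV-refl v = dec-true (v ≟ᵛ v) refl

    eqV-false : ∀ {v w} → v ≢ w → eqV v w ≡ false
    eqV-false {v} {w} = dec-false (v ≟ᵛ w)

  -- The extra special points (1 , 1 , m − 2) and (1 , m − 1 , 0) of the case m ≡ 4 (mod 6) lie in X₁₀₂
  -- and X₀₂₁, and X₂₁₀, Y₂₁₀ use direction 0 in colour 2; so both cases agree off X₁₀₂ ∪ X₀₂₁.
  colour₂-outside : ∀ {v} → ¬ In102 1 v → ¬ In021 1 v → v ≢ (4 + n , 1 , 1) → v ≢ (4 + n , 2 , 0) →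
                    colour₂ (tripleS0 m v) ≡ d0
  colour₂-outside {v} ∉X102 ∉X021 ≢a ≢b with m % 6 ≡ᵇ 4
  ... | false rewrite in102-false 1 v ∉X102 | in021-false 1 v ∉X021 | eqV-false ≢a | eqV-false ≢b
    = colour₂-if (inX210 m v) refl refl
  ... | true rewrite in102-false 2 v (∉X102 ∘ In102-mono (s≤s z≤n)) | in021-false 2 v (∉X021 ∘ In021-mono (s≤s z≤n))
                   | eqV-false {v} {1 , 1 , 4 + n} (λ { refl → ∉X102 (inj₂ (inj₁ ((s≤s z≤n , s≤s z≤n) , refl , refl))) })
                   | eqV-false ≢a
                   | eqV-false {v} {1 , 5 + n , 0} (λ { refl → ∉X021 (inj₂ (inj₁ ((s≤s z≤n , s≤s z≤n) , refl , refl))) })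
                   | eqV-false ≢b
    = colour₂-if (inY210 m v) refl refl

  colour₂-generic : ∀ {i j k} → j ≢ 1 → k ≢ 0 → (i , j , k) ≢ (5 + n , 2 , 5 + n) → (i , j , k) ≢ (5 + n , 0 , 1) →
                    colour₂ (tripleS0 m (i , j , k)) ≡ d0
  colour₂-generic j≢1 k≢0 ≢c ≢c' =
    colour₂-outside (∉102 j≢1 (λ { refl → k≢0 refl }) ≢c) (∉021 k≢0 (λ { refl → j≢1 refl }) ≢c')
                (λ { refl → j≢1 refl }) (λ { refl → k≢0 refl })

  colour₂[0,0,0] : colour₂ (tripleS0 m (0 , 0 , 0)) ≡ d2
  colour₂[0,0,0] with m % 6 ≡ᵇ 4
  ... | false = refl
  ... | true = refl

  colour₂[m-1,2,m-1] : colour₂ (tripleS0 m (5 + n , 2 , 5 + n)) ≡ d2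
  colour₂[m-1,2,m-1] with m % 6 ≡ᵇ 4
  ... | false rewrite in102-true 1 (5 + n , 2 , 5 + n) (inj₂ (inj₂ refl)) = refl
  ... | true rewrite in102-true 2 (5 + n , 2 , 5 + n) (inj₂ (inj₂ refl)) = refl

  colour₂[0,1,m-1] : colour₂ (tripleS0 m (0 , 1 , 5 + n)) ≡ d1
  colour₂[0,1,m-1] with m % 6 ≡ᵇ 4
  ... | false rewrite in021-true 1 (0 , 1 , 5 + n) (inj₁ refl) = refl
  ... | true rewrite in021-true 2 (0 , 1 , 5 + n) (inj₁ refl) = refl

  colour₂[m-1,0,1] : colour₂ (tripleS0 m (5 + n , 0 , 1)) ≡ d1
  colour₂[m-1,0,1] with m % 6 ≡ᵇ 4
  ... | false rewrite in102-false 1 (5 + n , 0 , 1) (∉102 (λ ()) (λ ()) (λ ()))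
                    | in021-true 1 (5 + n , 0 , 1) (inj₂ (inj₂ refl)) = refl
  ... | true rewrite in102-false 2 (5 + n , 0 , 1) (∉102 (λ ()) (λ ()) (λ ()))
                   | in021-true 2 (5 + n , 0 , 1) (inj₂ (inj₂ refl)) = refl

  private
    colour₂[1,1,m-2] : colour₂ (tripleS0 m (1 , 1 , 4 + n)) ≡ d2
    colour₂[1,1,m-2] with m % 6 ≡ᵇ 4
    ... | false rewrite in102-true 1 (1 , 1 , 4 + n) (inj₂ (inj₁ ((≤-refl , s≤s z≤n) , refl , refl))) = refl
    ... | true rewrite eqV-refl (1 , 1 , 4 + n) = refl

    colour₂-X102-middle : ∀ i → 2 ≤ i → i ≤ 3 + n → colour₂ (tripleS0 m (i , 1 , 5 + n ∸ i)) ≡ d2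
    colour₂-X102-middle i 2≤i i≤3+n with m % 6 ≡ᵇ 4
    ... | false rewrite in102-true 1 (i , 1 , 5 + n ∸ i)
                          (inj₂ (inj₁ ((≤-trans (s≤s z≤n) 2≤i , i≤3+n) , refl , refl))) = refl
    ... | true rewrite in102-true 2 (i , 1 , 5 + n ∸ i) (inj₂ (inj₁ ((2≤i , i≤3+n) , refl , refl))) = refl

    colour₂[m-2,1,1] : colour₂ (tripleS0 m (4 + n , 1 , 1)) ≡ d2
    colour₂[m-2,1,1] with m % 6 ≡ᵇ 4
    ... | false rewrite in102-false 1 (4 + n , 1 , 1) (∉102-beyond ≤-refl (λ ()) (λ ()))
                      | in021-false 1 (4 + n , 1 , 1) (∉021 (λ ()) (λ ()) (λ ()))
                      | eqV-refl (4 + n , 1 , 1) = refl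
    ... | true rewrite in102-false 2 (4 + n , 1 , 1) (∉102-beyond ≤-refl (λ ()) (λ ()))
                     | in021-false 2 (4 + n , 1 , 1) (∉021 (λ ()) (λ ()) (λ ()))
                     | eqV-refl (4 + n , 1 , 1) = refl

  colour₂-X102 : ∀ i → 1 ≤ i → i ≤ 4 + n → colour₂ (tripleS0 m (i , 1 , 5 + n ∸ i)) ≡ d2
  colour₂-X102 1 _ _ = colour₂[1,1,m-2]
  colour₂-X102 i@(suc (suc _)) _ i≤4+n with i ≤? 3 + n
  ... | yes i≤3+n = colour₂-X102-middle i (s≤s (s≤s z≤n)) i≤3+n
  ... | no i≰3+n with refl ← ≤-antisym i≤4+n (≰⇒> i≰3+n) =
    subst (λ k → colour₂ (tripleS0 m (4 + n , 1 , k)) ≡ d2) (sym (m+n∸n≡m 1 n)) colour₂[m-2,1,1]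

  private
    colour₂[1,m-1,0] : colour₂ (tripleS0 m (1 , 5 + n , 0)) ≡ d1
    colour₂[1,m-1,0] with m % 6 ≡ᵇ 4
    ... | false rewrite in021-true 1 (1 , 5 + n , 0) (inj₂ (inj₁ ((≤-refl , s≤s z≤n) , refl , refl))) = refl
    ... | true rewrite ≤ᵇ-false {5 + n} {4 + n} ≤-refl | eqV-refl (1 , 5 + n , 0) = refl

    X021-middle-∉102 : ∀ {lo i} → 2 ≤ i → i ≤ 3 + n → ¬ In102 lo (i , m ∸ i , 0)
    X021-middle-∉102 {i = i} 2≤i i≤3+n = ∉102 m∸i≢1 (λ e → <⇒≢ (≤-trans (s≤s z≤n) 2≤i) (sym (cong proj₁ e))) (λ ())
      where
      m∸i≢1 : m ∸ i ≢ 1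
      m∸i≢1 m∸i≡1 = <⇒≱ (s≤s (s≤s z≤n))
        (subst₂ _≤_ (m+n∸n≡m 3 n) m∸i≡1 (∸-monoʳ-≤ m i≤3+n))

    colour₂-X021-middle : ∀ i → 2 ≤ i → i ≤ 3 + n → colour₂ (tripleS0 m (i , m ∸ i , 0)) ≡ d1
    colour₂-X021-middle i 2≤i i≤3+n with m % 6 ≡ᵇ 4
    ... | false rewrite in102-false 1 (i , m ∸ i , 0) (X021-middle-∉102 2≤i i≤3+n)
                      | in021-true 1 (i , m ∸ i , 0)
                          (inj₂ (inj₁ ((≤-trans (s≤s z≤n) 2≤i , i≤3+n) , refl , refl))) = refl
    ... | true rewrite in102-false 2 (i , m ∸ i , 0) (X021-middle-∉102 2≤i i≤3+n)
                     | in021-true 2 (i , m ∸ i , 0) (inj₂ (inj₁ ((2≤i , i≤3+n) , refl , refl))) = refl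

    colour₂[m-2,2,0] : colour₂ (tripleS0 m (4 + n , 2 , 0)) ≡ d1
    colour₂[m-2,2,0] with m % 6 ≡ᵇ 4
    ... | false rewrite in102-false 1 (4 + n , 2 , 0) (∉102 (λ ()) (λ ()) (λ ()))
                      | in021-false 1 (4 + n , 2 , 0) (∉021-beyond ≤-refl (λ ()) (λ ()))
                      | eqV-false {4 + n , 2 , 0} {4 + n , 1 , 1} (λ ()) | eqV-refl (4 + n , 2 , 0) = refl
    ... | true rewrite in102-false 2 (4 + n , 2 , 0) (∉102 (λ ()) (λ ()) (λ ()))
                     | in021-false 2 (4 + n , 2 , 0) (∉021-beyond ≤-refl (λ ()) (λ ()))
                     | eqV-false {4 + n , 2 , 0} {4 + n , 1 , 1} (λ ()) | eqV-refl (4 + n , 2 , 0) = refl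

  colour₂-X021 : ∀ i → 1 ≤ i → i ≤ 4 + n → colour₂ (tripleS0 m (i , m ∸ i , 0)) ≡ d1
  colour₂-X021 1 _ _ = colour₂[1,m-1,0]
  colour₂-X021 i@(suc (suc _)) _ i≤4+n with i ≤? 3 + n
  ... | yes i≤3+n = colour₂-X021-middle i (s≤s (s≤s z≤n)) i≤3+n
  ... | no i≰3+n with refl ← ≤-antisym i≤4+n (≰⇒> i≰3+n) =
    subst (λ j → colour₂ (tripleS0 m (4 + n , j , 0)) ≡ d1) (sym (m+n∸n≡m 2 n)) colour₂[m-2,2,0]

-- One step of R₂, for m = 6 + n

module OneStep (n : ℕ) where

  open LayerZero n public
  open LayerZeroSets m
  open Residues m
  open Layers m
  open ≡-Reasoning

  private
    3≤m : 3 ≤ m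
    3≤m = s≤s (s≤s (s≤s z≤n))

    module Via = FromLayer1 3≤m

    inc-top : inc m (5 + n) ≡ 0
    inc-top = inc-last refl

    negm-suc : ∀ z → negm m (suc z) ≡ m ∸ suc z
    negm-suc z = cong (_∸ suc z) (+-identityʳ m)

    negm-top : negm m (5 + n) ≡ 1
    negm-top = trans (negm-suc (4 + n)) (m+n∸n≡m 1 n)

    subm-top : ∀ {y} → y < 5 + n → subm m y (5 + n) ≡ suc y
    subm-top {y} y<5+n = begin
      subm m y (5 + n)        ≡⟨ subm-> y<5+n ⟩
      m + y ∸ (5 + n)         ≡⟨ cong (_∸ (5 + n)) (+-suc (5 + n) y) ⟨
      5 + n + suc y ∸ (5 + n) ≡⟨ m+n∸m≡n (5 + n) (suc y) ⟩
      suc y                   ∎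

    1+a∸[a∸b]≡1+b : ∀ {a b} → b ≤ a → suc a ∸ (a ∸ b) ≡ suc b
    1+a∸[a∸b]≡1+b {a} {b} b≤a = trans (+-∸-assoc 1 (m∸n≤m a b)) (cong suc (m∸[m∸n]≡n b≤a))

    <m : ∀ {x} → x ≤ 5 + n → x < m
    <m = s≤s

  R2[x,0] : ∀ x → x ≤ 3 + n → R₂ m (suc x , 0) ≡ (2 + x , 5 + n)
  R2[x,0] x x≤3+n = begin
    R₂ m (suc x , 0)     ≡⟨ Via.R2-i₁≢0 (<m (s≤s (m≤n⇒m≤1+n x≤3+n))) (s≤s z≤n) refl layer0 v₁≡ (λ ()) (s≤s (s≤s z≤n)) ⟩
    (2 + x , negm m 1)   ≡⟨ cong (2 + x ,_) (negm-suc 0) ⟩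
    (2 + x , 5 + n)      ∎
    where
    k = subm m 0 (suc x)
    layer0 : colour₂ (tripleS0 m (suc x , 0 , k)) ≡ d0
    layer0 = colour₂-generic (λ ()) (subm≢0 {y = 0} (<m (s≤s (m≤n⇒m≤1+n x≤3+n))) (λ ())) (λ ())
                             (λ e → <⇒≢ (s≤s (s≤s x≤3+n)) (cong proj₁ e))
    v₁≡ : step m d0 (suc x , 0 , k) ≡ (2 + x , 0 , k)
    v₁≡ = cong (λ a → (a , 0 , k)) (inc-below (<m (s≤s (s≤s x≤3+n))))

  R2[x,m-1] : ∀ x → x ≤ 4 + n → R₂ m (x , 5 + n) ≡ (x , 4 + n)
  R2[x,m-1] zero _ = begin
    R₂ m (0 , 5 + n)     ≡⟨ Via.R2-i₁≡0-j₁≢0 (s≤s z≤n) ≤-refl v≡ colour₂[0,1,m-1] refl (λ ()) ⟩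
    (0 , negm m 2)       ≡⟨ cong (0 ,_) (negm-suc 1) ⟩
    (0 , 4 + n)          ∎
    where
    v≡ : toVertex m (0 , 5 + n) ≡ (0 , 1 , 5 + n)
    v≡ = cong (λ j → (0 , j , 5 + n)) negm-top
  R2[x,m-1] (suc x) x<4+n = begin
    R₂ m (suc x , 5 + n)   ≡⟨ Via.R2-i₁≢0 (<m (s≤s (<⇒≤ x<4+n))) ≤-refl v≡ (colour₂-X102 (suc x) (s≤s z≤n) x<4+n)
                                          refl (λ ()) (s≤s (s≤s (s≤s z≤n))) ⟩
    (suc x , negm m 2)     ≡⟨ cong (suc x ,_) (negm-suc 1) ⟩
    (suc x , 4 + n)        ∎
    where
    v≡ : toVertex m (suc x , 5 + n) ≡ (suc x , 1 , 5 + n ∸ suc x)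
    v≡ = cong₂ (λ j k → (suc x , j , k)) negm-top (subm-≤ (s≤s (<⇒≤ x<4+n)))

  R2[x,y] : ∀ x y → x ≤ 4 + n → 2 ≤ y → y ≤ 4 + n → x ≢ y → R₂ m (x , y) ≡ (suc x , pred y)
  R2[x,y] x 1 _ (s≤s ()) _ _
  R2[x,y] x (suc (suc y)) x≤4+n _ 2+y≤4+n x≢y = begin
    R₂ m (x , 2 + y)             ≡⟨ Via.R2-i₁≢0 (<m (m≤n⇒m≤1+n x≤4+n)) (<m (s≤s (s≤s (m≤n⇒m≤1+n (≤-pred (≤-pred 2+y≤4+n))))))
                                                v≡ layer0 v₁≡ (λ ()) (<m (s≤s (m∸n≤m (4 + n) y))) ⟩
    (suc x , negm m (suc j))     ≡⟨ cong (suc x ,_) (negm-suc j) ⟩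
    (suc x , suc (4 + n) ∸ j)    ≡⟨ cong (suc x ,_) (1+a∸[a∸b]≡1+b (m≤n⇒m≤o+n 2 (≤-pred (≤-pred 2+y≤4+n)))) ⟩
    (suc x , suc y)              ∎
    where
    j = 4 + n ∸ y
    k = subm m (2 + y) x
    v≡ : toVertex m (x , 2 + y) ≡ (x , j , k)
    v≡ = cong (λ j → (x , j , k)) (negm-suc (suc y))
    2≤j : 2 ≤ j
    2≤j = subst (_≤ j) (m+n∸n≡m 2 n) (∸-monoʳ-≤ (4 + n) (≤-pred (≤-pred 2+y≤4+n)))
    x≢5+n : x ≢ 5 + n
    x≢5+n = <⇒≢ (s≤s x≤4+n)
    layer0 : colour₂ (tripleS0 m (x , j , k)) ≡ d0
    layer0 = colour₂-generic (λ j≡1 → <⇒≢ 2≤j (sym j≡1)) (subm≢0 (<m (m≤n⇒m≤1+n x≤4+n)) x≢y)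
                             (λ e → x≢5+n (cong proj₁ e)) (λ e → x≢5+n (cong proj₁ e))
    v₁≡ : step m d0 (x , j , k) ≡ (suc x , j , k)
    v₁≡ = cong (λ a → (a , j , k)) (inc-below (<m (s≤s x≤4+n)))

  R2[m-1,y] : ∀ y → 1 ≤ y → y ≤ 3 + n → R₂ m (5 + n , y) ≡ (0 , y)
  R2[m-1,y] (suc y) _ 1+y≤3+n = begin
    R₂ m (5 + n , suc y)    ≡⟨ Via.R2-i₁≡0-j₁≢0 ≤-refl (<m (s≤s (m≤n⇒m≤1+n (<⇒≤ 1+y≤3+n)))) v≡ layer0 v₁≡ j≢0 ⟩
    (0 , negm m j)          ≡⟨ cong (λ j → (0 , negm m j)) (+-∸-assoc 1 y≤4+n) ⟩
    (0 , negm m (suc (4 + n ∸ y)))  ≡⟨ cong (0 ,_) (negm-suc (4 + n ∸ y)) ⟩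
    (0 , suc (4 + n) ∸ (4 + n ∸ y)) ≡⟨ cong (0 ,_) (1+a∸[a∸b]≡1+b y≤4+n) ⟩
    (0 , suc y)             ∎
    where
    y≤4+n : y ≤ 4 + n
    y≤4+n = m≤n⇒m≤o+n 2 (≤-pred 1+y≤3+n)
    j = 5 + n ∸ y
    k = subm m (suc y) (5 + n)
    v≡ : toVertex m (5 + n , suc y) ≡ (5 + n , j , k)
    v≡ = cong (λ j → (5 + n , j , k)) (negm-suc y)
    3≤j : 3 ≤ j
    3≤j = subst (_≤ j) (m+n∸n≡m 3 n) (∸-monoʳ-≤ (5 + n) (≤-pred 1+y≤3+n))
    j≢0 : j ≢ 0
    j≢0 j≡0 = <⇒≢ (≤-trans (s≤s z≤n) 3≤j) (sym j≡0)
    layer0 : colour₂ (tripleS0 m (5 + n , j , k)) ≡ d0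
    layer0 = colour₂-generic (λ j≡1 → <⇒≢ (≤-trans (s≤s (s≤s z≤n)) 3≤j) (sym j≡1))
                             (subm≢0 ≤-refl (λ e → <⇒≢ (m≤n⇒m≤1+n 1+y≤3+n) (sym (suc-injective e))))
                             (λ e → <⇒≢ 3≤j (sym (cong (proj₁ ∘ proj₂) e))) (λ e → j≢0 (cong (proj₁ ∘ proj₂) e))
    v₁≡ : step m d0 (5 + n , j , k) ≡ (0 , j , k)
    v₁≡ = cong (λ a → (a , j , k)) inc-top

  R2[a,a] : ∀ a → a ≤ 1 + n → R₂ m (3 + a , 3 + a) ≡ (3 + a , 1 + a)
  R2[a,a] a a≤1+n = begin
    R₂ m (3 + a , 3 + a)          ≡⟨ Via.R2-i₁≢0 3+a<m 3+a<m v≡ (colour₂-X021 (3 + a) (s≤s z≤n) (s≤s (s≤s (s≤s a≤1+n))))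
                                                v₁≡ (λ ()) (<m (s≤s (s≤s (m∸n≤m (3 + n) a)))) ⟩
    (3 + a , negm m (2 + j))      ≡⟨ cong (3 + a ,_) (negm-suc (1 + j)) ⟩
    (3 + a , suc (3 + n) ∸ j)     ≡⟨ cong (3 + a ,_) (1+a∸[a∸b]≡1+b (m≤n⇒m≤o+n 2 a≤1+n)) ⟩
    (3 + a , 1 + a)               ∎
    where
    j = 3 + n ∸ a
    3+a<m : 3 + a < m
    3+a<m = <m (s≤s (s≤s (s≤s (m≤n⇒m≤o+n 1 a≤1+n))))
    v≡ : toVertex m (3 + a , 3 + a) ≡ (3 + a , m ∸ (3 + a) , 0)
    v≡ = cong₂ (λ j k → (3 + a , j , k)) (negm-suc (2 + a)) (subm-diag (3 + a))
    v₁≡ : step m d1 (3 + a , j , 0) ≡ (3 + a , suc j , 0)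
    v₁≡ = cong (λ b → (3 + a , b , 0)) (inc-below (<m (s≤s (m≤n⇒m≤1+n (m∸n≤m (3 + n) a)))))

  R2[2,2] : R₂ m (2 , 2) ≡ (3 , 0)
  R2[2,2] = Via.R2-i₁≢0-j₁≡top (<m (s≤s (s≤s z≤n))) (<m (s≤s (s≤s z≤n))) v≡ (colour₂-X021 2 (s≤s z≤n) (s≤s (s≤s z≤n)))
                                v₁≡ (λ ()) refl
    where
    v≡ : toVertex m (2 , 2) ≡ (2 , 4 + n , 0)
    v≡ = cong (λ j → (2 , j , 0)) (negm-suc 1)
    v₁≡ : step m d1 (2 , 4 + n , 0) ≡ (2 , 5 + n , 0)
    v₁≡ = cong (λ j → (2 , j , 0)) (inc-below ≤-refl)

  R2[1,1] : R₂ m (1 , 1) ≡ (1 , 5 + n)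
  R2[1,1] = begin
    R₂ m (1 , 1)     ≡⟨ Via.R2-i₁≢0 (<m (s≤s z≤n)) (<m (s≤s z≤n)) v≡ (colour₂-X021 1 ≤-refl (s≤s z≤n)) v₁≡ (λ ()) (<m (s≤s z≤n)) ⟩
    (1 , negm m 1)   ≡⟨ cong (1 ,_) (negm-suc 0) ⟩
    (1 , 5 + n)      ∎
    where
    v≡ : toVertex m (1 , 1) ≡ (1 , 5 + n , 0)
    v≡ = cong (λ j → (1 , j , 0)) (negm-suc 0)
    v₁≡ : step m d1 (1 , 5 + n , 0) ≡ (1 , 0 , 0)
    v₁≡ = cong (λ j → (1 , j , 0)) inc-top

  private
    R2[x,1]′ : ∀ x → x ≤ 4 + n → x ≢ 1 → R₂ m (x , 1) ≡ (inc m (suc x) , 0)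
    R2[x,1]′ x x≤4+n x≢1 =
      Via.R2-i₁≢0-j₁≡top x<m (<m (s≤s z≤n)) v≡ layer0 v₁≡ (λ ()) refl
      where
      x<m = <m (m≤n⇒m≤1+n x≤4+n)
      k = subm m 1 x
      v≡ : toVertex m (x , 1) ≡ (x , 5 + n , k)
      v≡ = cong (λ j → (x , j , k)) (negm-suc 0)
      layer0 : colour₂ (tripleS0 m (x , 5 + n , k)) ≡ d0
      layer0 = colour₂-generic (λ ()) (subm≢0 x<m x≢1) (λ ()) (λ ())
      v₁≡ : step m d0 (x , 5 + n , k) ≡ (suc x , 5 + n , k)
      v₁≡ = cong (λ a → (a , 5 + n , k)) (inc-below (<m (s≤s x≤4+n)))

  R2[x,1] : ∀ x → x ≤ 3 + n → x ≢ 1 → R₂ m (x , 1) ≡ (2 + x , 0)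
  R2[x,1] x x≤3+n x≢1 = trans (R2[x,1]′ x (m≤n⇒m≤1+n x≤3+n) x≢1) (cong (_, 0) (inc-below (<m (s≤s (s≤s x≤3+n)))))

  R2[m-2,1] : R₂ m (4 + n , 1) ≡ (0 , 0)
  R2[m-2,1] = trans (R2[x,1]′ (4 + n) ≤-refl (λ ())) (cong (_, 0) inc-top)

  R2[0,0] : R₂ m (0 , 0) ≡ (1 , 0)
  R2[0,0] = Via.R2-i₁≡0-j₁≡0 (<m z≤n) (<m z≤n) refl colour₂[0,0,0] refl

  R2[m-1,0] : R₂ m (5 + n , 0) ≡ (5 + n , 4 + n)
  R2[m-1,0] = begin
    R₂ m (5 + n , 0)       ≡⟨ Via.R2-i₁≢0 ≤-refl (<m z≤n) v≡ colour₂[m-1,0,1] refl (λ ()) (<m (s≤s (s≤s z≤n))) ⟩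
    (5 + n , negm m 2)     ≡⟨ cong (5 + n ,_) (negm-suc 1) ⟩
    (5 + n , 4 + n)        ∎
    where
    v≡ : toVertex m (5 + n , 0) ≡ (5 + n , 0 , 1)
    v≡ = cong (λ k → (5 + n , 0 , k)) (subm-top (s≤s z≤n))

  R2[m-1,m-2] : R₂ m (5 + n , 4 + n) ≡ (5 + n , 3 + n)
  R2[m-1,m-2] = begin
    R₂ m (5 + n , 4 + n)   ≡⟨ Via.R2-i₁≢0 ≤-refl (<m (m≤n⇒m≤1+n ≤-refl)) v≡ colour₂[m-1,2,m-1]
                                          refl (λ ()) (<m (s≤s (s≤s (s≤s z≤n)))) ⟩
    (5 + n , negm m 3)     ≡⟨ cong (5 + n ,_) (negm-suc 2) ⟩
    (5 + n , 3 + n)        ∎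
    where
    v≡ : toVertex m (5 + n , 4 + n) ≡ (5 + n , 2 , 5 + n)
    v≡ = cong₂ (λ j k → (5 + n , j , k)) (trans (negm-suc (3 + n)) (m+n∸n≡m 2 n)) (subm-top ≤-refl)

  R2[m-1,m-1] : R₂ m (5 + n , 5 + n) ≡ (0 , 5 + n)
  R2[m-1,m-1] = begin
    R₂ m (5 + n , 5 + n)   ≡⟨ Via.R2-i₁≡0-j₁≢0 ≤-refl ≤-refl v≡ layer0 v₁≡ (λ ()) ⟩
    (0 , negm m 1)         ≡⟨ cong (0 ,_) (negm-suc 0) ⟩
    (0 , 5 + n)            ∎
    where
    v≡ : toVertex m (5 + n , 5 + n) ≡ (5 + n , 1 , 0)
    v≡ = cong₂ (λ j k → (5 + n , j , k)) negm-top (subm-diag (5 + n))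
    layer0 : colour₂ (tripleS0 m (5 + n , 1 , 0)) ≡ d0
    layer0 = colour₂-outside (∉102-beyond (s≤s (s≤s (m≤n⇒m≤1+n ≤-refl))) (λ ()) (λ ()))
                         (∉021-beyond (s≤s (s≤s (m≤n⇒m≤1+n ≤-refl))) (λ ()) (λ ())) (λ ()) (λ ())
    v₁≡ : step m d0 (5 + n , 1 , 0) ≡ (0 , 1 , 0)
    v₁≡ = cong (λ a → (a , 1 , 0)) inc-top

-- Orbits

module Runs (n : ℕ) where

  open OneStep n
  open Paths (R₂ m) (λ p → NonZero (proj₂ p)) public

  Avoids : ℕ → ℕ → ℕ → Set
  Avoids zero    x y = ⊤
  Avoids (suc s) x y = x ≢ suc s + y × Avoids s (suc x) y

  avoids-above : ∀ s x y → s + x ≤ y → Avoids s x y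
  avoids-above zero    x y _ = _
  avoids-above (suc s) x y 1+s+x≤y =
    (λ x≡ → <⇒≢ (≤-<-trans (≤-trans (m≤n+m x (suc s)) 1+s+x≤y) (m<n+m y (s≤s z≤n))) x≡) ,
    avoids-above s (suc x) y (subst (_≤ y) (sym (+-suc s x)) 1+s+x≤y)

  avoids-below : ∀ s x y → s + y < x → Avoids s x y
  avoids-below zero    x y _ = _
  avoids-below (suc s) x y 1+s+y<x =
    (λ x≡ → <⇒≢ 1+s+y<x (sym x≡)) ,
    avoids-below s (suc x) y (m<n⇒m<1+n (<-trans (n<1+n (s + y)) 1+s+y<x))

  avoids-odd : ∀ s x y q → x + (s + y) ≡ suc (2 * q) → Avoids s x y
  avoids-odd zero    x y q _ = _
  avoids-odd (suc s) x y q odd =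
    (λ x≡ → even≢odd x q (trans (cong (x +_) (trans (+-identityʳ x) x≡)) odd)) ,
    avoids-odd s (suc x) y q (trans (sym (+-suc x (s + y))) odd)

  private
    run-from : ∀ s x y → 1 ≤ y → s + x ≤ 5 + n → s + y ≤ 4 + n → Avoids s x y →
               Path s (x , s + y) (s + x , y)
    run-from zero    x y _ _ _ _ = path-refl
    run-from (suc s) x y 1≤y 1+s+x≤ 1+s+y≤ (x≢ , avoids) =
      subst (λ x′ → Path (suc s) (x , suc s + y) (x′ , y)) (+-suc s x)
        (path-++ (path-step (R2[x,y] x (suc s + y) x≤4+n (s≤s (≤-trans 1≤y (m≤n+m y s))) 1+s+y≤ x≢))
                 (λ _ → >-nonZero (≤-trans 1≤y (m≤n+m y s)))
                 (run-from s (suc x) y 1≤y (subst (_≤ 5 + n) (sym (+-suc s x)) 1+s+x≤) (<⇒≤ 1+s+y≤) avoids))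
      where
      x≤4+n : x ≤ 4 + n
      x≤4+n = ≤-pred (≤-trans (s≤s (m≤n+m x s)) 1+s+x≤)

  run : ∀ s {x y x′ y′} → x′ ≡ s + x → y ≡ s + y′ → 1 ≤ y′ → x′ ≤ 5 + n → y ≤ 4 + n → Avoids s x y′ →
        Path s (x , y) (x′ , y′)
  run s {x} {y′ = y′} refl refl = run-from s x y′

module Orbits (h : ℕ) where

  open Runs (2 * h) public
  open OneStep (2 * h)

  private
    double-≤ : ∀ {a} c → a ≤ c + h → 2 * a ≤ 2 * c + 2 * h
    double-≤ {a} c a≤c+h = subst (2 * a ≤_) (*-distribˡ-+ 2 c h) (*-monoʳ-≤ 2 a≤c+h)

  descend-odd : ∀ e → e ≤ 1 + h → Path (1 + 2 * e) (0 , 1 + 2 * e) (2 + 2 * e , 0)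
  descend-odd e e≤1+h = path-cast (+-comm (2 * e) 1) refl refl (
    (0 , 1 + 2 * e)   ⟶⟨ run (2 * e) (sym (+-identityʳ (2 * e))) (+-comm 1 (2 * e)) (s≤s z≤n) (m≤n⇒m≤o+n 3 2e≤2+n)
                              (s≤s (m≤n⇒m≤1+n 2e≤2+n)) (avoids-odd (2 * e) 0 1 e (+-comm (2 * e) 1)) ⟩
    (2 * e , 1)       ⟶⟨ path-step (R2[x,1] (2 * e) (m≤n⇒m≤1+n 2e≤2+n) (even≢odd e 0)) ⟩∎)
    where
    2e≤2+n : 2 * e ≤ 2 + 2 * h
    2e≤2+n = double-≤ 1 e≤1+h

  leave-diagonal : ∀ b → b ≤ 1 + h → Path (1 + b) (2 + b , 2 + b) (3 + 2 * b , 0)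
  leave-diagonal zero    _ = path-step R2[2,2]
  leave-diagonal (suc g) g<1+h = path-cast (+-comm (1 + g) 1) refl (cong (_, 0) x-end) (
    (3 + g , 3 + g)   ⟶⟨ path-step (R2[a,a] g (m≤n⇒m≤1+n g≤n)) ⟩
    (3 + g , 1 + g)   ⟶⟨ run g x′≡ (+-comm 1 g) (s≤s z≤n) (s≤s (s≤s (s≤s (m≤n⇒m≤o+n 2 2g≤n))))
                             (s≤s (m≤n⇒m≤o+n 3 g≤n))
                             (avoids-below g (3 + g) 1 (s≤s (≤-trans (≤-reflexive (+-comm g 1)) (n≤1+n (suc g))))) ⟩
    (3 + 2 * g , 1)   ⟶⟨ path-step (R2[x,1] (3 + 2 * g) (s≤s (s≤s (s≤s 2g≤n))) (λ ())) ⟩∎)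
    where
    x′≡ : 3 + 2 * g ≡ g + (3 + g)
    x′≡ = solve (g ∷ [])
    x-end : 2 + (3 + 2 * g) ≡ 3 + 2 * suc g
    x-end = solve (g ∷ [])
    2g≤n : 2 * g ≤ 2 * h
    2g≤n = double-≤ 0 (≤-pred g<1+h)
    g≤n : g ≤ 2 * h
    g≤n = ≤-trans (m≤m+n g (g + 0)) 2g≤n

  descend-even : ∀ b → b ≤ h → Path (3 + 2 * b) (0 , 4 + 2 * b) (3 + 2 * b , 0)
  descend-even b b≤h = path-cast length refl refl (
    (0 , 4 + 2 * b)   ⟶⟨ run (2 + b) (sym (+-identityʳ (2 + b))) y≡ (s≤s z≤n) (s≤s (s≤s (m≤n⇒m≤o+n 3 b≤n)))
                              (s≤s (s≤s (s≤s (s≤s 2b≤n)))) (avoids-above (2 + b) 0 (2 + b) (≤-reflexive (+-identityʳ (2 + b)))) ⟩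
    (2 + b , 2 + b)   ⟶⟨ leave-diagonal b (m≤n⇒m≤1+n b≤h) ⟩∎)
    where
    y≡ : 4 + 2 * b ≡ 2 + b + (2 + b)
    y≡ = solve (b ∷ [])
    length : 2 + b + (1 + b) ≡ 3 + 2 * b
    length = solve (b ∷ [])
    2b≤n : 2 * b ≤ 2 * h
    2b≤n = double-≤ 0 b≤h
    b≤n : b ≤ 2 * h
    b≤n = ≤-trans (m≤m+n b (b + 0)) 2b≤n

module _ (e d : ℕ) where

  open Orbits (e + d)
  open OneStep (2 * (e + d))

  climb-odd : Path (5 + 2 * d) (3 + 2 * e , 0) (0 , 1 + 2 * e)
  climb-odd = path-cast length refl refl (
    (3 + 2 * e , 0)                  ⟶⟨ path-step (R2[x,0] (2 + 2 * e) (m+n≡o⇒m≤o (1 + 2 * d) (solve (e ∷ d ∷ [])))) ⟩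
    (4 + 2 * e , 5 + 2 * (e + d))    ⟶⟨ path-step (R2[x,m-1] (4 + 2 * e) (m+n≡o⇒m≤o (2 * d) (solve (e ∷ d ∷ [])))) ⟩
    (4 + 2 * e , 4 + 2 * (e + d))    ⟶⟨ run d (+-comm (4 + 2 * e) d) y₁≡ (s≤s z≤n) (m+n≡o⇒m≤o (1 + d) (solve (e ∷ d ∷ []))) ≤-refl
                                               (avoids-above d (4 + 2 * e) (4 + 2 * e + d) (≤-reflexive (+-comm d (4 + 2 * e)))) ⟩
    (4 + 2 * e + d , 4 + 2 * e + d)  ⟶⟨ path-step (R2[a,a] (1 + 2 * e + d) (m+n≡o⇒m≤o d (solve (e ∷ d ∷ [])))) ⟩
    (4 + 2 * e + d , 2 + 2 * e + d)  ⟶⟨ run (1 + d) x₂≡ y₂≡ (s≤s z≤n) ≤-refl (m+n≡o⇒m≤o (2 + d) (solve (e ∷ d ∷ [])))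
                                               (avoids-below (1 + d) (4 + 2 * e + d) (1 + 2 * e) (m+n≡o⇒m≤o 1 (solve (e ∷ d ∷ [])))) ⟩
    (5 + 2 * (e + d) , 1 + 2 * e)    ⟶⟨ path-step (R2[m-1,y] (1 + 2 * e) (s≤s z≤n)
                                                               (m+n≡o⇒m≤o (2 + 2 * d) (solve (e ∷ d ∷ [])))) ⟩∎)
    where
    y₁≡ : 4 + 2 * (e + d) ≡ d + (4 + 2 * e + d)
    y₁≡ = solve (e ∷ d ∷ [])
    x₂≡ : 5 + 2 * (e + d) ≡ 1 + d + (4 + 2 * e + d)
    x₂≡ = solve (e ∷ d ∷ [])
    y₂≡ : 2 + 2 * e + d ≡ 1 + d + (1 + 2 * e)
    y₂≡ = solve (e ∷ d ∷ [])
    length : 1 + (1 + (d + (1 + (1 + d + 1)))) ≡ 5 + 2 * d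
    length = solve (d ∷ [])

module _ (c d : ℕ) where

  open Orbits (c + d)
  open OneStep (2 * (c + d))

  climb-even : Path (5 + 2 * d) (2 + 2 * c , 0) (0 , 2 + 2 * c)
  climb-even = path-cast length refl refl (
    (2 + 2 * c , 0)                ⟶⟨ path-step (R2[x,0] (1 + 2 * c) (m+n≡o⇒m≤o (2 + 2 * d) (solve (c ∷ d ∷ [])))) ⟩
    (3 + 2 * c , 5 + 2 * (c + d))  ⟶⟨ path-step (R2[x,m-1] (3 + 2 * c) (m+n≡o⇒m≤o (1 + 2 * d) (solve (c ∷ d ∷ [])))) ⟩
    (3 + 2 * c , 4 + 2 * (c + d))  ⟶⟨ run (2 + 2 * d) x≡ y≡ (s≤s z≤n) ≤-refl ≤-refl
                                             (avoids-odd (2 + 2 * d) (3 + 2 * c) (2 + 2 * c) (3 + 2 * c + d) (solve (c ∷ d ∷ []))) ⟩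
    (5 + 2 * (c + d) , 2 + 2 * c)  ⟶⟨ path-step (R2[m-1,y] (2 + 2 * c) (s≤s z≤n)
                                                             (m+n≡o⇒m≤o (1 + 2 * d) (solve (c ∷ d ∷ [])))) ⟩∎)
    where
    x≡ : 5 + 2 * (c + d) ≡ 2 + 2 * d + (3 + 2 * c)
    x≡ = solve (c ∷ d ∷ [])
    y≡ : 4 + 2 * (c + d) ≡ 2 + 2 * d + (2 + 2 * c)
    y≡ = solve (c ∷ d ∷ [])
    length : 1 + (1 + (2 + 2 * d + 1)) ≡ 5 + 2 * d
    length = solve (d ∷ [])

module _ (h : ℕ) where

  open Orbits h
  open OneStep (2 * h)

  orbit[0] : Path 1 (0 , 0) (1 , 0)
  orbit[0] = path-step R2[0,0]

  orbit[1] : Path (5 + 2 * h) (1 , 0) (5 + 2 * h , 0)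
  orbit[1] = path-cast length refl (cong (_, 0) x-end) (
    (1 , 0)            ⟶⟨ path-step (R2[x,0] 0 z≤n) ⟩
    (2 , 5 + 2 * h)    ⟶⟨ path-step (R2[x,m-1] 2 (s≤s (s≤s z≤n))) ⟩
    (2 , 4 + 2 * h)    ⟶⟨ run (1 + h) (+-comm 2 (1 + h)) y≡ (s≤s z≤n) (m+n≡o⇒m≤o (2 + h) (solve (h ∷ []))) ≤-refl
                                (avoids-above (1 + h) 2 (3 + h) (≤-reflexive (+-comm (1 + h) 2))) ⟩
    (3 + h , 3 + h)    ⟶⟨ leave-diagonal (1 + h) ≤-refl ⟩∎)
    where
    y≡ : 4 + 2 * h ≡ 1 + h + (3 + h)
    y≡ = solve (h ∷ [])
    x-end : 3 + 2 * (1 + h) ≡ 5 + 2 * h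
    x-end = solve (h ∷ [])
    length : 1 + (1 + (1 + h + (1 + (1 + h)))) ≡ 5 + 2 * h
    length = solve (h ∷ [])

  orbit[2] : Path (2 * (6 + 2 * h)) (2 , 0) (0 , 0)
  orbit[2] = path-cast length refl refl (
    (2 , 0)            ⟶⟨ climb-even 0 h ⟩
    (0 , 2)            ⟶⟨ path-step (R2[x,y] 0 2 z≤n (s≤s (s≤s z≤n)) (s≤s (s≤s z≤n)) (λ ())) ⟩
    (1 , 1)            ⟶⟨ path-step R2[1,1] ⟩
    (1 , 5 + 2 * h)    ⟶⟨ path-step (R2[x,m-1] 1 (s≤s z≤n)) ⟩
    (1 , 4 + 2 * h)    ⟶⟨ run (3 + 2 * h) (+-comm 1 (3 + 2 * h)) (+-comm 1 (3 + 2 * h)) (s≤s z≤n) (m≤n⇒m≤1+n ≤-refl) ≤-refl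
                                (avoids-odd (3 + 2 * h) 1 1 (2 + h) (solve (h ∷ []))) ⟩
    (4 + 2 * h , 1)    ⟶⟨ path-step R2[m-2,1] ⟩∎)
    where
    length : 5 + 2 * h + (1 + (1 + (1 + (3 + 2 * h + 1)))) ≡ 2 * (6 + 2 * h)
    length = solve (h ∷ [])

  orbit[m-1] : Path (6 + 2 * h) (5 + 2 * h , 0) (4 + 2 * h , 0)
  orbit[m-1] = path-cast length refl refl (
    (5 + 2 * h , 0)        ⟶⟨ path-step R2[m-1,0] ⟩
    (5 + 2 * h , 4 + 2 * h) ⟶⟨ path-step R2[m-1,m-2] ⟩
    (5 + 2 * h , 3 + 2 * h) ⟶⟨ path-step (R2[m-1,y] (3 + 2 * h) (s≤s z≤n) ≤-refl) ⟩
    (0 , 3 + 2 * h)        ⟶⟨ path-cast refl (cong (0 ,_) y≡) (cong (_, 0) x≡) (descend-odd (1 + h) ≤-refl) ⟩∎)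
    where
    y≡ : 1 + 2 * (1 + h) ≡ 3 + 2 * h
    y≡ = solve (h ∷ [])
    x≡ : 2 + 2 * (1 + h) ≡ 4 + 2 * h
    x≡ = solve (h ∷ [])
    length : 1 + (1 + (1 + (1 + 2 * (1 + h)))) ≡ 6 + 2 * h
    length = solve (h ∷ [])

  orbit[m-2] : Path (6 + 2 * h) (4 + 2 * h , 0) (3 + 2 * h , 0)
  orbit[m-2] =
    (4 + 2 * h , 0)      ⟶⟨ path-step (R2[x,0] (3 + 2 * h) ≤-refl) ⟩
    (5 + 2 * h , 5 + 2 * h) ⟶⟨ path-step R2[m-1,m-1] ⟩
    (0 , 5 + 2 * h)      ⟶⟨ path-step (R2[x,m-1] 0 z≤n) ⟩
    (0 , 4 + 2 * h)      ⟶⟨ descend-even h ≤-refl ⟩∎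

orbit-odd : ∀ e d → Orbits.Path (e + d) (6 + 2 * (e + d)) (3 + 2 * e , 0) (2 + 2 * e , 0)
orbit-odd e d =
  path-cast length refl refl (path-++ (climb-odd e d) (λ _ → nonZero) (descend-odd e (m≤n⇒m≤1+n (m≤m+n e d))))
  where
  open Orbits (e + d)
  length : 5 + 2 * d + (1 + 2 * e) ≡ 6 + 2 * (e + d)
  length = solve (e ∷ d ∷ [])

orbit-even : ∀ b d → Orbits.Path (1 + b + d) (6 + 2 * (1 + b + d)) (4 + 2 * b , 0) (3 + 2 * b , 0)
orbit-even b d =
  path-cast length (cong (_, 0) (sym x≡)) refl
    (path-++ (climb-even (1 + b) d) (λ _ → nonZero)
             (path-cast refl (cong (0 ,_) x≡) refl (descend-even b (m≤n⇒m≤1+n (m≤m+n b d)))))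
  where
  open Orbits (1 + b + d)
  x≡ : 4 + 2 * b ≡ 2 + 2 * (1 + b)
  x≡ = solve (b ∷ [])
  length : 5 + 2 * d + (3 + 2 * b) ≡ 6 + 2 * (1 + b + d)
  length = solve (b ∷ d ∷ [])

data EvenOrOdd : ℕ → Set where
  even : ∀ k → EvenOrOdd (2 * k)
  odd  : ∀ k → EvenOrOdd (1 + 2 * k)

even-or-odd : ∀ n → EvenOrOdd n
even-or-odd zero = even 0
even-or-odd (suc n) with even-or-odd n
... | even k = odd k
... | odd k = subst EvenOrOdd (*-distribˡ-+ 2 1 k) (even (suc k))

shift-world : ∀ {h h′ a b} → h ≡ h′ → Orbits.Path h (6 + 2 * h) a b → Orbits.Path h′ (6 + 2 * h′) a b
shift-world refl p = p

half-≤ : ∀ {k h} → 2 * k ≤ 2 + 2 * h → k ≤ 1 + h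
half-≤ {k} {h} = *-cancelˡ-≤ 2 ∘ subst (2 * k ≤_) (sym (*-distribˡ-+ 2 1 h))

half-< : ∀ {k h} → 2 * k < 2 + 2 * h → k ≤ h
half-< {k} {h} = ≤-pred ∘ *-cancelˡ-< 2 k (1 + h) ∘ subst (2 * k <_) (sym (*-distribˡ-+ 2 1 h))

orbit : ∀ h x → x < 6 + 2 * h → Orbits.Path h (rho2claim (6 + 2 * h) x) (x , 0) (T2claim (6 + 2 * h) x , 0)
orbit h 0 _ = orbit[0] h
orbit h 1 _ = orbit[1] h
orbit h 2 _ = orbit[2] h
orbit h (suc (suc (suc x))) x<m with even-or-odd x
... | even e with e ≤? h
...   | yes e≤h = shift-world (m+[n∸m]≡n e≤h) (orbit-odd e (h ∸ e))
...   | no e≰h with refl ← ≤-antisym (half-≤ (≤-pred (≤-pred (≤-pred (≤-pred x<m))))) (≰⇒> e≰h) =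
  Orbits.path-cast h refl (cong (_, 0) x≡) (cong (_, 0) (cong pred x≡)) (orbit[m-1] h)
  where
  x≡ : 5 + 2 * h ≡ 3 + 2 * suc h
  x≡ = solve (h ∷ [])
orbit h (suc (suc (suc x))) x<m | odd b with suc b ≤? h
...   | yes b<h = shift-world (m+[n∸m]≡n b<h) (orbit-even b (h ∸ suc b))
...   | no b≮h with refl ← ≤-antisym (half-< (≤-pred (≤-pred (≤-pred (≤-pred x<m))))) (≤-pred (≰⇒> b≮h)) = orbit[m-2] h

iter-R2≡iter-R₂ : ∀ m t p → iter (R2 m) t p ≡ iter (R₂ m) t p
iter-R2≡iter-R₂ m zero    p = refl
iter-R2≡iter-R₂ m (suc t) p =
  trans (cong (R2 m) {iter (R2 m) t p} {iter (R₂ m) t p} (iter-R2≡iter-R₂ m t p)) (sym (R₂≡R2 m (iter (R₂ m) t p)))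

first-return : ∀ m {t x y} → Paths.Path (R₂ m) (λ p → NonZero (proj₂ p)) t (x , 0) (y , 0) →
               (iter (R2 m) t (x , 0) ≡ (y , 0)) × ((s : ℕ) → 1 ≤ s → s < t → proj₂ (iter (R2 m) s (x , 0)) ≢ 0)
first-return m {t} {x} (Paths.path reach avoid) =
  trans (iter-R2≡iter-R₂ m t (x , 0)) reach ,
  λ s 1≤s s<t → subst (λ q → proj₂ q ≢ 0) (sym (iter-R2≡iter-R₂ m s (x , 0))) (≢-nonZero⁻¹ _ {{avoid s 1≤s s<t}})

even-world : ∀ {m} → 6 ≤ m → 2 ∣ m → Σ ℕ (λ h → m ≡ 6 + 2 * h)
even-world 6≤m (divides q refl) = from-quotient q 6≤m
  where
  from-quotient : ∀ q → 6 ≤ q * 2 → Σ ℕ (λ h → q * 2 ≡ 6 + 2 * h)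
  from-quotient (suc (suc (suc h))) _ = h , cong (6 +_) (*-comm h 2)
  from-quotient 0 ()
  from-quotient 1 (s≤s (s≤s ()))
  from-quotient 2 (s≤s (s≤s (s≤s (s≤s ()))))

FirstReturn : ℕ → ℕ → Set
FirstReturn m x = (iter (R2 m) (rho2claim m x) (x , 0) ≡ (T2claim m x , 0))
                × ((t : ℕ) → 1 ≤ t → t < rho2claim m x → proj₂ (iter (R2 m) t (x , 0)) ≢ 0)

first-return-in-world : ∀ {m} → Σ ℕ (λ h → m ≡ 6 + 2 * h) → ∀ x → x < m → FirstReturn m x
first-return-in-world (h , refl) x x<m = first-return (6 + 2 * h) (orbit h x x<m)

proposition4p24 : (m : ℕ) → 6 ≤ m → 2 ∣ m → (x : ℕ) → x < m →
    (iter (R2 m) (rho2claim m x) (x , 0) ≡ (T2claim m x , 0))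
    × ((t : ℕ) → 1 ≤ t → t < rho2claim m x → proj₂ (iter (R2 m) t (x , 0)) ≢ 0)
proposition4p24 m 6≤m 2∣m = first-return-in-world (even-world 6≤m 2∣m)
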